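{- Let $\sigma,\rho$ be non-empty finite or cofinite subsets of $\mathbb{Z}_{\ge0}$, and let $s\in\sigma$, $r\in\rho$ with $r\ge1$. Then there is a graph $G$ with a vertex $u$ such that $(G,\{u\})$ is a $\{\sigma_s,\rho_r\}$-provider and $G$ has disjoint $(\sigma,\rho)$-sets $X$ and $Y$ with $X\cup Y=V(G)$, $u\in X$ with $|N(u)\cap X|=s$, and $u\notin Y$ with $|N(u)\cap Y|=r$.
   Context: A $(\sigma,\rho)$-set of $G$ is $S\subseteq V(G)$ with $|N(v)\cap S|\in\sigma$ for $v\in S$ and $|N(v)\cap S|\in\rho$ for $v\notin S$. For a graph $G$ and $U\subseteq V(G)$ (portals), a partial solution is $S\subseteq V(G)$ such that $|N(v)\cap S|\in\rho$ for all $v\in V(G)\setminus(S\cup U)$ and $|N(v)\cap S|\in\sigma$ for all $v\in S\setminus U$. A string $x$ over symbols $\{\sigma_i,\rho_i:i\ge0\}$ indexed by $U$ is compatible with $(G,U)$ if some partial solution $S$ satisfies, for each $v\in U$, $x[v]=\sigma_{|N(v)\cap S|}$ if $v\in S$ and $x[v]=\rho_{|N(v)\cap S|}$ if $v\notin S$. $(G,U)$ is an $L$-provider if every string of $L$ is compatible with $(G,U)$. -}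

module Defs where

open import Data.Nat using (ℕ)
open import Data.Bool using (Bool; true; false)
open import Data.Fin using (Fin)
open import Data.Fin.Subset using (Subset; _∈_; _∉_; _∩_; ∣_∣)
open import Data.Vec using (tabulate)
open import Data.List using (List)
open import Data.List.Membership.Propositional renaming (_∈_ to _∈ₗ_; _∉_ to _∉ₗ_)
open import Relation.Binary.PropositionalEquality using (_≡_)
open import Data.Product using (Σ; _×_)
open import Data.Sum using (_⊎_)
open import Relation.Nullary using (¬_)

data FinCofinSet : Set where
  finite   : List ℕ → FinCofinSet
  cofinite : List ℕ → FinCofinSet

_∈ℕ_ : ℕ → FinCofinSet → Set
n ∈ℕ finite xs   = n ∈ₗ xs
n ∈ℕ cofinite xs = n ∉ₗ xs

NonEmpty : FinCofinSet → Set
NonEmpty A = Σ ℕ λ n → n ∈ℕ A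

record Graph : Set where
  field
    n     : ℕ
    adj   : Fin n → Fin n → Bool
    sym   : ∀ v w → adj v w ≡ adj w v
    irrefl : ∀ v → adj v v ≡ false
open Graph public

N : (G : Graph) → Fin (n G) → Subset (n G)
N G v = tabulate (adj G v)

nbCount : (G : Graph) → Subset (n G) → Fin (n G) → ℕ
nbCount G S v = ∣ N G v ∩ S ∣

IsSigmaRhoSet : FinCofinSet → FinCofinSet → (G : Graph) → Subset (n G) → Set
IsSigmaRhoSet σ ρ G S =
  ∀ v → (v ∈ S → nbCount G S v ∈ℕ σ) × (v ∉ S → nbCount G S v ∈ℕ ρ)

IsPartialSolution : FinCofinSet → FinCofinSet → (G : Graph) → Subset (n G) → Subset (n G) → Set
IsPartialSolution σ ρ G U S =
  ∀ v → v ∉ U → (v ∈ S → nbCount G S v ∈ℕ σ) × (v ∉ S → nbCount G S v ∈ℕ ρ)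

data Symbol : Set where
  σsym : ℕ → Symbol
  ρsym : ℕ → Symbol

PortalString : (G : Graph) → Subset (n G) → Set
PortalString G U = (v : Fin (n G)) → v ∈ U → Symbol

Realizes : (G : Graph) → Subset (n G) → Fin (n G) → Symbol → Set
Realizes G S v (σsym i) = v ∈ S × nbCount G S v ≡ i
Realizes G S v (ρsym i) = v ∉ S × nbCount G S v ≡ i

Compatible : FinCofinSet → FinCofinSet → (G : Graph) → (U : Subset (n G)) → PortalString G U → Set
Compatible σ ρ G U x =
  Σ (Subset (n G)) λ S → IsPartialSolution σ ρ G U S × (∀ v (p : v ∈ U) → Realizes G S v (x v p))

-- A language is a predicate on portal strings.
IsProvider : FinCofinSet → FinCofinSet → (G : Graph) → (U : Subset (n G))
           → (PortalString G U → Set) → Set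
IsProvider σ ρ G U L = ∀ x → L x → Compatible σ ρ G U x

Pair : (G : Graph) → (U : Subset (n G)) → Symbol → Symbol → PortalString G U → Set
Pair G U a b x = (∀ v (p : v ∈ U) → x v p ≡ a) ⊎ (∀ v (p : v ∈ U) → x v p ≡ b)

{-# OPTIONS --safe #-}
-- Take two sides, each made of r disjoint copies of the clique K_{s+1} with vertices
-- labelled by positions 0..s, and join every vertex to the r vertices carrying the same
-- position on the other side. Every vertex then has exactly s neighbours on its own side
-- and r on the other, so each side is a ({s},{r})-set and hence a (σ,ρ)-set; the two sides
-- partition the graph, and they realise σ_s and ρ_r respectively at any vertex u of the first side.
-- Vertices are encoded as combine t (combine a b), and neighbour counts are computed by
-- factoring the counted predicate along this product decomposition.
module Submission where

open import Defs hiding (sym)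
open import Data.Nat using (ℕ; _≥_; zero; suc; _+_; _*_; s≤s)
open import Data.Nat.Properties using (*-identityˡ; *-identityʳ)
open import Data.Bool using (Bool; true; false; _∧_; not; if_then_else_)
open import Data.Bool.Properties using (∧-comm; ∧-identityʳ; ∧-zeroʳ)
open import Data.Fin using (Fin; zero; suc; combine; remQuot; _↑ˡ_; _↑ʳ_)
open import Data.Fin.Properties using (remQuot-combine; 0≢1+n)
open import Data.Fin.Subset using (Subset; _∈_; _∉_; _∩_; ∣_∣; ⁅_⁆)
open import Data.Fin.Subset.Properties using (x∈⁅y⁆⇒x≡y)
open import Data.List using ([]; _∷_)
open import Data.List.Relation.Unary.Any using (here)
open import Data.Product using (Σ; ∃; _×_; _,_; proj₁; proj₂; map₂; uncurry)
open import Data.Sum using (_⊎_; inj₁; inj₂)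
open import Data.Empty using (⊥-elim)
open import Data.Vec using (tabulate; _∷_)
open import Data.Vec.Properties using (tabulate-cong; lookup∘tabulate; []=⇒lookup; lookup⇒[]=)
open import Function using (_∘_)
open import Relation.Binary.PropositionalEquality
  using (_≡_; refl; sym; trans; cong; cong₂; subst; module ≡-Reasoning)

tabulate-∩ : ∀ {n} (f g : Fin n → Bool) → tabulate f ∩ tabulate g ≡ tabulate (λ i → f i ∧ g i)
tabulate-∩ {zero}  f g = refl
tabulate-∩ {suc n} f g = cong (f zero ∧ g zero ∷_) (tabulate-∩ (f ∘ suc) (g ∘ suc))

∈-tabulate⁻ : ∀ {n} (f : Fin n → Bool) {i} → i ∈ tabulate f → f i ≡ true
∈-tabulate⁻ f {i} i∈ = trans (sym (lookup∘tabulate f i)) ([]=⇒lookup i∈)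

∈-tabulate⁺ : ∀ {n} (f : Fin n → Bool) {i} → f i ≡ true → i ∈ tabulate f
∈-tabulate⁺ f {i} fi≡true = lookup⇒[]= i _ (trans (lookup∘tabulate f i) fi≡true)

∣tabulate-false∣ : ∀ n → ∣ tabulate {n} (λ _ → false) ∣ ≡ 0
∣tabulate-false∣ zero    = refl
∣tabulate-false∣ (suc n) = ∣tabulate-false∣ n

∣tabulate-true∣ : ∀ n → ∣ tabulate {n} (λ _ → true) ∣ ≡ n
∣tabulate-true∣ zero    = refl
∣tabulate-true∣ (suc n) = cong suc (∣tabulate-true∣ n)

∣tabulate∣-+ : ∀ k {m} (h : Fin (k + m) → Bool) →
  ∣ tabulate h ∣ ≡ ∣ tabulate (h ∘ (_↑ˡ m)) ∣ + ∣ tabulate (h ∘ (k ↑ʳ_)) ∣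
∣tabulate∣-+ zero    h = refl
∣tabulate∣-+ (suc k) h with h zero
... | true  = cong suc (∣tabulate∣-+ k (h ∘ suc))
... | false = ∣tabulate∣-+ k (h ∘ suc)

∣tabulate∣-* : ∀ {m k} (h : Fin (m * k) → Bool) (f : Fin m → Bool) (g : Fin k → Bool) →
  (∀ i j → h (combine i j) ≡ f i ∧ g j) → ∣ tabulate h ∣ ≡ ∣ tabulate f ∣ * ∣ tabulate g ∣
∣tabulate∣-* {zero}      h f g h≡f∧g = refl
∣tabulate∣-* {suc m} {k} h f g h≡f∧g = begin
  ∣ tabulate h ∣
    ≡⟨ ∣tabulate∣-+ k h ⟩
  ∣ tabulate (h ∘ (_↑ˡ m * k)) ∣ + ∣ tabulate (h ∘ (k ↑ʳ_)) ∣
    ≡⟨ cong₂ _+_ (cong ∣_∣ (tabulate-cong (h≡f∧g zero)))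
                 (∣tabulate∣-* (h ∘ (k ↑ʳ_)) (f ∘ suc) g (h≡f∧g ∘ suc)) ⟩
  ∣ tabulate (λ j → f zero ∧ g j) ∣ + ∣ tabulate (f ∘ suc) ∣ * ∣ tabulate g ∣
    ≡⟨ first-row (f zero) refl ⟩
  ∣ tabulate f ∣ * ∣ tabulate g ∣ ∎
  where
  open ≡-Reasoning
  first-row : ∀ b → f zero ≡ b →
    ∣ tabulate (λ j → b ∧ g j) ∣ + ∣ tabulate (f ∘ suc) ∣ * ∣ tabulate g ∣ ≡ ∣ tabulate f ∣ * ∣ tabulate g ∣
  first-row true  f₀≡b rewrite f₀≡b = refl
  first-row false f₀≡b rewrite f₀≡b | ∣tabulate-false∣ k = refl

_≡ᵇ_ : ∀ {n} → Fin n → Fin n → Bool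
zero  ≡ᵇ zero  = true
suc i ≡ᵇ suc j = i ≡ᵇ j
_     ≡ᵇ _     = false

≡ᵇ-refl : ∀ {n} (i : Fin n) → i ≡ᵇ i ≡ true
≡ᵇ-refl zero    = refl
≡ᵇ-refl (suc i) = ≡ᵇ-refl i

≡ᵇ-sym : ∀ {n} (i j : Fin n) → i ≡ᵇ j ≡ j ≡ᵇ i
≡ᵇ-sym zero    zero    = refl
≡ᵇ-sym zero    (suc j) = refl
≡ᵇ-sym (suc i) zero    = refl
≡ᵇ-sym (suc i) (suc j) = ≡ᵇ-sym i j

≡ᵇ⇒≡ : ∀ {n} {i j : Fin n} → i ≡ᵇ j ≡ true → i ≡ j
≡ᵇ⇒≡ {i = zero}  {zero}  _    = refl
≡ᵇ⇒≡ {i = suc i} {suc j} i≡ᵇj = cong suc (≡ᵇ⇒≡ i≡ᵇj)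

∣tabulate-≡ᵇ∣ : ∀ {n} (i : Fin n) → ∣ tabulate (i ≡ᵇ_) ∣ ≡ 1
∣tabulate-≡ᵇ∣ {suc n} zero    = cong suc (∣tabulate-false∣ n)
∣tabulate-≡ᵇ∣         (suc i) = ∣tabulate-≡ᵇ∣ i

∣tabulate-≢ᵇ∣ : ∀ {n} (i : Fin (suc n)) → ∣ tabulate (λ j → not (i ≡ᵇ j)) ∣ ≡ n
∣tabulate-≢ᵇ∣ {n}     zero    = ∣tabulate-true∣ n
∣tabulate-≢ᵇ∣ {suc n} (suc i) = cong suc (∣tabulate-≢ᵇ∣ i)

IsSigmaRhoSet-mono : ∀ {σ ρ σ′ ρ′ G S} → (∀ {k} → k ∈ℕ σ → k ∈ℕ σ′) → (∀ {k} → k ∈ℕ ρ → k ∈ℕ ρ′) →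
  IsSigmaRhoSet σ ρ G S → IsSigmaRhoSet σ′ ρ′ G S
IsSigmaRhoSet-mono σ⊆σ′ ρ⊆ρ′ isSet v = σ⊆σ′ ∘ proj₁ (isSet v) , ρ⊆ρ′ ∘ proj₂ (isSet v)

singleton⊆ : ∀ {k σ} → k ∈ℕ σ → ∀ {j} → j ∈ℕ finite (k ∷ []) → j ∈ℕ σ
singleton⊆ k∈σ (here refl) = k∈σ

IsSigmaRhoSet⇒IsPartialSolution : ∀ {σ ρ G U S} → IsSigmaRhoSet σ ρ G S → IsPartialSolution σ ρ G U S
IsSigmaRhoSet⇒IsPartialSolution isSet v _ = isSet v

constant-compatible : ∀ {σ ρ G u a} (x : PortalString G ⁅ u ⁆) → (∀ v p → x v p ≡ a) →
  (∃ λ S → IsPartialSolution σ ρ G ⁅ u ⁆ S × Realizes G S u a) → Compatible σ ρ G ⁅ u ⁆ x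
constant-compatible {u = u} x x≡a (S , partial , realizes) = S , partial , realizes′
  where
  realizes′ : ∀ v (p : v ∈ ⁅ u ⁆) → Realizes _ S v (x v p)
  realizes′ v p with refl ← x∈⁅y⁆⇒x≡y u p = subst (Realizes _ S u) (sym (x≡a u p)) realizes

singleton-provider : ∀ {σ ρ G u a b} →
  (∃ λ S → IsPartialSolution σ ρ G ⁅ u ⁆ S × Realizes G S u a) →
  (∃ λ S → IsPartialSolution σ ρ G ⁅ u ⁆ S × Realizes G S u b) →
  IsProvider σ ρ G ⁅ u ⁆ (Pair G ⁅ u ⁆ a b)
singleton-provider realizesA _ x (inj₁ x≡a) = constant-compatible x x≡a realizesA
singleton-provider _ realizesB x (inj₂ x≡b) = constant-compatible x x≡b realizesB

module TwoSidedCliques (s r : ℕ) where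

  Coordinates : Set
  Coordinates = Fin 2 × Fin (suc s) × Fin r

  size : ℕ
  size = 2 * (suc s * r)

  vertex : Coordinates → Fin size
  vertex (t , a , b) = combine t (combine a b)

  coordinates : Fin size → Coordinates
  coordinates v = map₂ (remQuot r) (remQuot (suc s * r) v)

  coordinates-vertex : ∀ t a b → coordinates (vertex (t , a , b)) ≡ (t , a , b)
  coordinates-vertex t a b =
    trans (cong (map₂ (remQuot r)) (remQuot-combine t (combine a b))) (cong (t ,_) (remQuot-combine a b))

  ∣tabulate∣-coordinates : ∀ (h : Coordinates → Bool) f g k →
    (∀ t a b → h (t , a , b) ≡ f t ∧ (g a ∧ k b)) →
    ∣ tabulate (h ∘ coordinates) ∣ ≡ ∣ tabulate f ∣ * (∣ tabulate g ∣ * ∣ tabulate k ∣)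
  ∣tabulate∣-coordinates h f g k h≡f∧g∧k =
    trans (∣tabulate∣-* (h ∘ coordinates) f (uncurry g∧k ∘ remQuot r) split-side)
          (cong (∣ tabulate f ∣ *_) (∣tabulate∣-* _ g k split-position))
    where
    g∧k : Fin (suc s) → Fin r → Bool
    g∧k a b = g a ∧ k b
    split-position : ∀ a b → uncurry g∧k (remQuot r (combine a b)) ≡ g a ∧ k b
    split-position a b = cong (uncurry g∧k) (remQuot-combine a b)
    split-side : ∀ t x → h (coordinates (combine t x)) ≡ f t ∧ uncurry g∧k (remQuot r x)
    split-side t x = trans (cong (h ∘ map₂ (remQuot r)) (remQuot-combine t x)) (h≡f∧g∧k t _ _)

  adjacent : Coordinates → Coordinates → Bool
  adjacent (t , a , b) (t′ , a′ , b′) = if t ≡ᵇ t′ then b ≡ᵇ b′ ∧ not (a ≡ᵇ a′) else a ≡ᵇ a′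

  adjacent-sym : ∀ p q → adjacent p q ≡ adjacent q p
  adjacent-sym (t , a , b) (t′ , a′ , b′) rewrite ≡ᵇ-sym t t′ | ≡ᵇ-sym a a′ | ≡ᵇ-sym b b′ = refl

  adjacent-irrefl : ∀ p → adjacent p p ≡ false
  adjacent-irrefl (t , a , b) rewrite ≡ᵇ-refl t | ≡ᵇ-refl a = ∧-zeroʳ (b ≡ᵇ b)

  G : Graph
  G = record
    { n      = size
    ; adj    = λ v w → adjacent (coordinates v) (coordinates w)
    ; sym    = λ v w → adjacent-sym (coordinates v) (coordinates w)
    ; irrefl = λ v → adjacent-irrefl (coordinates v)
    }

  side : Fin size → Fin 2
  side = proj₁ ∘ coordinates

  Side : Fin 2 → Subset size
  Side c = tabulate (λ v → c ≡ᵇ side v)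

  neighbourOn : Fin 2 → Coordinates → Coordinates → Bool
  neighbourOn c p q = adjacent p q ∧ (c ≡ᵇ proj₁ q)

  neighbourOn-own-side : ∀ c t a b t′ a′ b′ → c ≡ᵇ t ≡ true →
    neighbourOn c (t , a , b) (t′ , a′ , b′) ≡ (c ≡ᵇ t′) ∧ (not (a ≡ᵇ a′) ∧ (b ≡ᵇ b′))
  neighbourOn-own-side c t a b t′ a′ b′ c≡ᵇt with refl ← ≡ᵇ⇒≡ {i = c} {t} c≡ᵇt with c ≡ᵇ t′
  ... | true  = trans (∧-identityʳ _) (∧-comm (b ≡ᵇ b′) _)
  ... | false = ∧-zeroʳ _

  neighbourOn-other-side : ∀ c t a b t′ a′ b′ → c ≡ᵇ t ≡ false →
    neighbourOn c (t , a , b) (t′ , a′ , b′) ≡ (c ≡ᵇ t′) ∧ ((a ≡ᵇ a′) ∧ true)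
  neighbourOn-other-side c t a b t′ a′ b′ c≢ᵇt with c ≡ᵇ t′ in c≡ᵇt′
  ... | true  with refl ← ≡ᵇ⇒≡ {i = c} {t′} c≡ᵇt′ rewrite ≡ᵇ-sym t c | c≢ᵇt = refl
  ... | false = ∧-zeroʳ _

  neighbours-in-Side : ∀ c p →
    ∣ tabulate (neighbourOn c p ∘ coordinates) ∣ ≡ (if c ≡ᵇ proj₁ p then s else r)
  neighbours-in-Side c (t , a , b) with c ≡ᵇ t in c≡ᵇt
  ... | true = begin
    _ ≡⟨ ∣tabulate∣-coordinates (neighbourOn c (t , a , b)) (c ≡ᵇ_) (λ a′ → not (a ≡ᵇ a′)) (b ≡ᵇ_)
           (λ t′ a′ b′ → neighbourOn-own-side c t a b t′ a′ b′ c≡ᵇt) ⟩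
    _ ≡⟨ cong₂ _*_ (∣tabulate-≡ᵇ∣ c) (cong₂ _*_ (∣tabulate-≢ᵇ∣ a) (∣tabulate-≡ᵇ∣ b)) ⟩
    1 * (s * 1) ≡⟨ trans (*-identityˡ _) (*-identityʳ s) ⟩
    s ∎
    where open ≡-Reasoning
  ... | false = begin
    _ ≡⟨ ∣tabulate∣-coordinates (neighbourOn c (t , a , b)) (c ≡ᵇ_) (a ≡ᵇ_) (λ _ → true)
           (λ t′ a′ b′ → neighbourOn-other-side c t a b t′ a′ b′ c≡ᵇt) ⟩
    _ ≡⟨ cong₂ _*_ (∣tabulate-≡ᵇ∣ c) (cong₂ _*_ (∣tabulate-≡ᵇ∣ a) (∣tabulate-true∣ r)) ⟩
    1 * (1 * r) ≡⟨ trans (*-identityˡ _) (*-identityˡ r) ⟩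
    r ∎
    where open ≡-Reasoning

  nbCount-Side : ∀ c v → nbCount G (Side c) v ≡ (if c ≡ᵇ side v then s else r)
  nbCount-Side c v =
    trans (cong ∣_∣ (tabulate-∩ (adj G v) (λ w → c ≡ᵇ side w))) (neighbours-in-Side c (coordinates v))

  ∈-Side⁺ : ∀ {c v} → c ≡ side v → v ∈ Side c
  ∈-Side⁺ {v = v} refl = ∈-tabulate⁺ _ (≡ᵇ-refl (side v))

  ∈-Side⁻ : ∀ {c v} → v ∈ Side c → c ≡ side v
  ∈-Side⁻ {c} {v} v∈Side = ≡ᵇ⇒≡ {i = c} {side v} (∈-tabulate⁻ _ v∈Side)

  Side-disjoint : ∀ {v} → v ∈ Side zero → v ∉ Side (suc zero)
  Side-disjoint v∈Side₀ v∈Side₁ = 0≢1+n (trans (∈-Side⁻ v∈Side₀) (sym (∈-Side⁻ v∈Side₁)))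

  Side-cover : ∀ v → v ∈ Side zero ⊎ v ∈ Side (suc zero)
  Side-cover v with side v | ∈-Side⁺ {side v} {v} refl
  ... | zero     | v∈Side₀ = inj₁ v∈Side₀
  ... | suc zero | v∈Side₁ = inj₂ v∈Side₁

  nbCount-Side-∈ : ∀ {c v} → v ∈ Side c → nbCount G (Side c) v ≡ s
  nbCount-Side-∈ {c} {v} v∈Side =
    trans (nbCount-Side c v) (cong (if_then s else r) (∈-tabulate⁻ _ v∈Side))

  nbCount-Side-∉ : ∀ {c v} → v ∉ Side c → nbCount G (Side c) v ≡ r
  nbCount-Side-∉ {c} {v} v∉Side with c ≡ᵇ side v in c≡ᵇsv
  ... | true  = ⊥-elim (v∉Side (∈-tabulate⁺ _ c≡ᵇsv))
  ... | false = trans (nbCount-Side c v) (cong (if_then s else r) c≡ᵇsv)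

  Side-isSigmaRhoSet : ∀ c → IsSigmaRhoSet (finite (s ∷ [])) (finite (r ∷ [])) G (Side c)
  Side-isSigmaRhoSet c v = here ∘ nbCount-Side-∈ {c} , here ∘ nbCount-Side-∉ {c}

lemma7p1 : (σ ρ : FinCofinSet) → NonEmpty σ → NonEmpty ρ
    → (s r : ℕ) → s ∈ℕ σ → r ∈ℕ ρ → r ≥ 1
    → Σ Graph λ G → Σ (Fin (n G)) λ u →
        IsProvider σ ρ G ⁅ u ⁆ (Pair G ⁅ u ⁆ (σsym s) (ρsym r))
        × Σ (Subset (n G)) λ X → Σ (Subset (n G)) λ Y →
            IsSigmaRhoSet σ ρ G X × IsSigmaRhoSet σ ρ G Y
            × (∀ v → v ∈ X → v ∉ Y)
            × (∀ v → v ∈ X ⊎ v ∈ Y)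
            × u ∈ X × nbCount G X u ≡ s
            × u ∉ Y × nbCount G Y u ≡ r
-- r ≥ 1 is needed only to make the vertex u = (0, 0, 0) exist.
lemma7p1 σ ρ _ _ s r s∈σ r∈ρ (s≤s _) =
  G , u , provider , Side zero , Side (suc zero) , isSigmaRhoSet zero , isSigmaRhoSet (suc zero) ,
  (λ _ → Side-disjoint) , Side-cover , u∈X , nbCount-Side-∈ {zero} u∈X , u∉Y , nbCount-Side-∉ {suc zero} u∉Y
  where
  open TwoSidedCliques s r
  u : Fin size
  u = vertex (zero , zero , zero)
  u∈X : u ∈ Side zero
  u∈X = ∈-Side⁺ (sym (cong proj₁ (coordinates-vertex zero zero zero)))
  u∉Y : u ∉ Side (suc zero)
  u∉Y = Side-disjoint u∈X
  isSigmaRhoSet : ∀ c → IsSigmaRhoSet σ ρ G (Side c)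
  isSigmaRhoSet c =
    IsSigmaRhoSet-mono {G = G} {Side c} (singleton⊆ {σ = σ} s∈σ) (singleton⊆ {σ = ρ} r∈ρ) (Side-isSigmaRhoSet c)
  partialSolution : ∀ c → IsPartialSolution σ ρ G ⁅ u ⁆ (Side c)
  partialSolution c = IsSigmaRhoSet⇒IsPartialSolution {G = G} {S = Side c} (isSigmaRhoSet c)
  provider : IsProvider σ ρ G ⁅ u ⁆ (Pair G ⁅ u ⁆ (σsym s) (ρsym r))
  provider = singleton-provider
    (Side zero , partialSolution zero , u∈X , nbCount-Side-∈ {zero} u∈X)
    (Side (suc zero) , partialSolution (suc zero) , u∉Y , nbCount-Side-∉ {suc zero} u∉Y)
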